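{- Let $k\ge 2$ be an integer and let $G$ be a finite, simple, connected, $k$-colourable graph such that the strong $k$-colour graph $S_k(G)$ is connected. Then $|V(G)|\ge k+1$, and $G$ does not contain a complete bipartite graph $K_{m,n}$ (with $m,n\ge 1$) as a spanning subgraph.
   Context: A proper $k$-colouring of a graph $G$ is a map $V(G)\to\{1,\dots,k\}$ giving adjacent vertices different colours. It is called a strong $k$-colouring if all $k$ colours actually appear. The strong $k$-colour graph $S_k(G)$ is the graph whose vertex set is the set of strong $k$-colourings of $G$, two colourings being adjacent if and only if they differ in colour on exactly one vertex of $G$. -}

module Defs where

open import Data.Nat using (ℕ; suc)
open import Data.Fin using (Fin)
open import Data.Bool using (Bool; true; false)
open import Data.Product using (Σ; ∃; _×_; _,_)
open import Relation.Binary.PropositionalEquality using (_≡_; _≢_)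
open import Relation.Nullary using (¬_)

record Graph (n : ℕ) : Set₁ where
  field
    Adj   : Fin n → Fin n → Set
    sym   : ∀ {u v} → Adj u v → Adj v u
    irrefl : ∀ {v} → ¬ Adj v v
open Graph public

data Walk {A : Set} (R : A → A → Set) : A → A → Set where
  [] : ∀ {x} → Walk R x x
  _∷_ : ∀ {x y z} → R x y → Walk R y z → Walk R x z

Connected : (A : Set) → (A → A → Set) → Set
Connected A R = A × (∀ x y → Walk R x y)

Proper : ∀ {n} → Graph n → (k : ℕ) → (Fin n → Fin k) → Set
Proper G k c = ∀ u v → Adj G u v → c u ≢ c v

Colourable : ∀ {n} → Graph n → ℕ → Set
Colourable {n} G k = Σ (Fin n → Fin k) (Proper G k)

IsStrong : ∀ {n} → Graph n → (k : ℕ) → (Fin n → Fin k) → Set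
IsStrong {n} G k c = Proper G k c × (∀ (i : Fin k) → ∃ λ (v : Fin n) → c v ≡ i)

StrongColouring : ∀ {n} → Graph n → ℕ → Set
StrongColouring {n} G k = Σ (Fin n → Fin k) (IsStrong G k)

SAdj : ∀ {n} (G : Graph n) (k : ℕ) → StrongColouring G k → StrongColouring G k → Set
SAdj {n} G k (c , _) (d , _) =
  ∃ λ (v : Fin n) → (c v ≢ d v) × (∀ w → w ≢ v → c w ≡ d w)

SkConnected : ∀ {n} → Graph n → ℕ → Set
SkConnected G k = Connected (StrongColouring G k) (SAdj G k)

GConnected : ∀ {n} → Graph n → Set
GConnected {n} G = Connected (Fin n) (Adj G)

-- G contains K_{m,n} (m,n ≥ 1) as a spanning subgraph: the vertex set splits
-- into two nonempty parts with every vertex of one part adjacent to every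
-- vertex of the other.
HasSpanningCompleteBipartite : ∀ {n} → Graph n → Set
HasSpanningCompleteBipartite {n} G =
  Σ (Fin n → Bool) λ side →
    (∃ λ a → side a ≡ true) × (∃ λ b → side b ≡ false) ×
    (∀ a b → side a ≡ true → side b ≡ false → Adj G a b)

-- Both claims come from recolouring a strong colouring c by the transposition
-- of two of its colours: connectivity of S_k(G) yields a walk from c to the
-- recoloured c, and each claim exhibits an invariant of walks that the
-- recolouring violates. If n ≤ k, a strong colouring is injective, so no
-- vertex can change colour without a collision: S_k(G) has no edges at all.
-- If G spans K_{A,B}, every colour is used on only one of A and B, and a
-- recolouring step can never move a colour from A to B, since the colour
-- being abandoned must reappear elsewhere, necessarily on the same side.
module Submission where

open import Defs hiding (sym)
open import Data.Bool using (Bool; true; false)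
open import Data.Empty using (⊥-elim)
open import Data.Fin using (Fin; punchOut; _≟_)
open import Data.Fin.Patterns using (0F; 1F)
open import Data.Fin.Permutation using (Permutation′; _⟨$⟩ʳ_; _⟨$⟩ˡ_; inverseʳ; transpose)
import Data.Fin.Permutation.Components as Components
open import Data.Fin.Properties using (injective⇒≤; punchOut-injective)
open import Data.Nat using (ℕ; suc; _≤_; _<_; _≥_; s≤s; _<?_)
open import Data.Nat.Properties using (<⇒≱; ≮⇒≥)
open import Data.Product using (_×_; _,_; proj₁; proj₂; ∃)
open import Function using (_∘_; Injection)
open import Function.Properties.Inverse using (↔⇒↣)
open import Function.Definitions using (Injective)
open import Relation.Binary.PropositionalEquality
open ≡-Reasoning
open import Relation.Nullary using (¬_; yes; no; contradiction)
open import Relation.Nullary.Decidable using (dec-true)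

walk-preserves : ∀ {A : Set} {R : A → A → Set} (P : A → Set) →
  (∀ {x y} → R x y → P x → P y) → ∀ {x y} → Walk R x y → P x → P y
walk-preserves P step []       px = px
walk-preserves P step (r ∷ rs) px = walk-preserves P step rs (step r px)

walk-without-edges : ∀ {A : Set} {R : A → A → Set} →
  (∀ x y → ¬ R x y) → ∀ {x y} → Walk R x y → x ≡ y
walk-without-edges noEdge []      = refl
walk-without-edges noEdge (r ∷ _) = ⊥-elim (noEdge _ _ r)

transpose[i,j]j≡i : ∀ {k} (i j : Fin k) → Components.transpose i j j ≡ i
transpose[i,j]j≡i i j with j ≟ i
... | yes j≡i = j≡i
... | no _ rewrite dec-true (j ≟ j) refl = refl

-- The two colliding vertices cannot both lie in the image of a section of c;
-- punching out one that does not turns the section into an injection Fin k → Fin (n - 1).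
surjective∧collision⇒< : ∀ {n k} (c : Fin n → Fin k) → (∀ i → ∃ λ v → c v ≡ i) →
  ∀ {v w} → v ≢ w → c v ≡ c w → k < n
surjective∧collision⇒< {suc n} {k} c surj {v} {w} v≢w cv≡cw =
  s≤s (injective⇒≤ {f = skip} skip-injective)
  where
  section : Fin k → Fin (suc n)
  section i = proj₁ (surj i)

  c∘section : ∀ i → c (section i) ≡ i
  c∘section i = proj₂ (surj i)

  section-injective : Injective _≡_ _≡_ section
  section-injective {i} {j} eq = trans (sym (c∘section i)) (trans (cong c eq) (c∘section j))

  outside-image : ∀ u → u ≢ section (c u) → ∀ i → u ≢ section i
  outside-image u u≢ i refl = u≢ (cong section (sym (c∘section i)))

  missed : ∃ λ u → u ≢ section (c u)
  missed with v ≟ section (c v)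
  ... | no v≢  = v , v≢
  ... | yes v≡ = w , λ w≡ → v≢w (trans v≡ (trans (cong section cv≡cw) (sym w≡)))

  missed∉image : ∀ i → proj₁ missed ≢ section i
  missed∉image = outside-image (proj₁ missed) (proj₂ missed)

  skip : Fin k → Fin n
  skip i = punchOut (missed∉image i)

  skip-injective : Injective _≡_ _≡_ skip
  skip-injective {i} {j} = section-injective ∘ punchOut-injective (missed∉image i) (missed∉image j)

module _ {n k : ℕ} (G : Graph n) where

  recolour : Permutation′ k → StrongColouring G k → StrongColouring G k
  recolour π (c , proper , surj) =
    (π ⟨$⟩ʳ_) ∘ c ,
    (λ u v uv → proper u v uv ∘ Injection.injective (↔⇒↣ π)) ,
    (λ i → proj₁ (surj (π ⟨$⟩ˡ i)) , trans (cong (π ⟨$⟩ʳ_) (proj₂ (surj (π ⟨$⟩ˡ i)))) (inverseʳ π))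

  SAdj-empty : n ≤ k → ∀ x y → ¬ SAdj G k x y
  SAdj-empty n≤k (d , _ , d-surj) (e , _ , e-surj) (v , dv≢ev , agree)
    with e-surj (d v)
  ... | w , ew≡dv with w ≟ v
  ...   | yes refl = dv≢ev (sym ew≡dv)
  ...   | no w≢v   = <⇒≱ (surjective∧collision⇒< d d-surj (w≢v ∘ sym) (sym (trans (agree w w≢v) ew≡dv))) n≤k

  SkConnected⇒k<n : 2 ≤ k → SkConnected G k → k < n
  SkConnected⇒k<n (s≤s (s≤s _)) (x@(c , _ , surj) , connected) with k <? n
  ... | yes k<n = k<n
  ... | no  k≮n = contradiction 0≡1 λ ()
    where
    -- SAdj computes once its arguments are η-expanded, so R cannot be inferred.
    x≡swapped : x ≡ recolour (transpose 0F 1F) x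
    x≡swapped = walk-without-edges {R = SAdj G k} (SAdj-empty (≮⇒≥ k≮n)) (connected _ _)

    v : Fin n
    v = proj₁ (surj 0F)

    0≡1 : 0F ≡ 1F
    0≡1 = begin
      0F                                ≡⟨ sym (proj₂ (surj 0F)) ⟩
      c v                               ≡⟨ cong (λ y → proj₁ y v) x≡swapped ⟩
      Components.transpose 0F 1F (c v)  ≡⟨ cong (Components.transpose 0F 1F) (proj₂ (surj 0F)) ⟩
      1F                                ∎

  module _ (side : Fin n → Bool) where

    UsedOn : Bool → (Fin n → Fin k) → Fin k → Set
    UsedOn s c i = ∃ λ v → side v ≡ s × c v ≡ i

    module _ (complete : ∀ a b → side a ≡ true → side b ≡ false → Adj G a b) where

      usedOn-true⇒¬usedOn-false : ∀ {c i} → Proper G k c → UsedOn true c i → ¬ UsedOn false c i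
      usedOn-true⇒¬usedOn-false proper (a , sa , ca) (b , sb , cb) =
        proper a b (complete a b sa sb) (trans ca (sym cb))

      SAdj-preserves-usedOn-true : ∀ i {x y} → SAdj G k x y → UsedOn true (proj₁ x) i → UsedOn true (proj₁ y) i
      SAdj-preserves-usedOn-true i {d , d-proper , _} {e , _ , e-surj} (v , dv≢ev , agree) (a , sa , da≡i)
        with a ≟ v
      ... | no a≢v = a , sa , trans (sym (agree a a≢v)) da≡i
      ... | yes refl with e-surj i
      ...   | w , ew≡i with side w in sw
      ...     | true  = w , sw , ew≡i
      ...     | false = ⊥-elim (usedOn-true⇒¬usedOn-false d-proper (a , sa , da≡i) (w , sw , trans (agree w w≢a) ew≡i))
        where
        w≢a : w ≢ a
        w≢a refl = dv≢ev (trans da≡i (sym ew≡i))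

  SkConnected⇒¬HasSpanningCompleteBipartite : SkConnected G k → ¬ HasSpanningCompleteBipartite G
  SkConnected⇒¬HasSpanningCompleteBipartite (x@(c , _ , _) , connected) (side , (a , sa) , (b , sb) , complete) =
    usedOn-true⇒¬usedOn-false side complete (proj₁ (proj₂ swapped)) ca-usedOn-A (b , sb , transpose[i,j]j≡i (c a) (c b))
    where
    swapped : StrongColouring G k
    swapped = recolour (transpose (c a) (c b)) x

    ca-usedOn-A : UsedOn side true (proj₁ swapped) (c a)
    ca-usedOn-A = walk-preserves {R = SAdj G k} (λ y → UsedOn side true (proj₁ y) (c a))
      (λ {y} {z} → SAdj-preserves-usedOn-true side complete (c a) {y} {z}) (connected x swapped) (a , sa , refl)

lemma2p1 : (k : ℕ) → k ≥ 2 → (n : ℕ) → (G : Graph n) →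
    GConnected G → Colourable G k → SkConnected G k →
    (n ≥ suc k) × ¬ HasSpanningCompleteBipartite G
lemma2p1 k k≥2 n G _ _ Sk-connected =
  SkConnected⇒k<n G k≥2 Sk-connected , SkConnected⇒¬HasSpanningCompleteBipartite G Sk-connected
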